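{- Let $G,H$ be groups, let $g_0,\dots,g_n\in G$, and let $h\in H$ with $h\neq 1_H$. Write $\mathbb{Z}/2\mathbb{Z}=\langle a\rangle$. Then $g_0ag_1a\cdots ag_n=1$ in the free product $G*(\mathbb{Z}/2\mathbb{Z})$ if and only if $g_0h^{ -1}g_1h\cdots h^{(-1)^n}g_n=1$ in the free product $G*H$ (where the powers of $h$ alternate $h^{ -1},h,h^{ -1},\dots$, the $k$-th occurrence being $h^{(-1)^k}$). -}

module Defs where

open import Level using (Level; _⊔_; 0ℓ)
open import Algebra.Bundles using (Group)
open import Algebra.Structures using (IsGroup)
open import Data.Bool using (Bool; true; false; _xor_)
open import Data.Bool.Properties using (xor-assoc; xor-identityˡ; xor-identityʳ)
open import Data.Nat using (ℕ; zero; suc)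
open import Data.Fin using (Fin; zero; suc)
open import Data.List using (List; []; _∷_; _++_)
open import Data.Sum using (_⊎_; inj₁; inj₂)
open import Data.Product using (_,_)
open import Function using (id; _∘_)
open import Relation.Binary.PropositionalEquality
  using (_≡_; refl; isEquivalence; cong; cong₂)

private
  xor-self : ∀ x → x xor x ≡ false
  xor-self false = refl
  xor-self true  = refl

Z2 : Group 0ℓ 0ℓ
Z2 = record
  { Carrier = Bool
  ; _≈_     = _≡_
  ; _∙_     = _xor_
  ; ε       = false
  ; _⁻¹     = id
  ; isGroup = record
    { isMonoid = record
      { isSemigroup = record
        { isMagma = record
          { isEquivalence = isEquivalence
          ; ∙-cong        = cong₂ _xor_
          }
        ; assoc = xor-assoc
        }
      ; identity = xor-identityˡ , xor-identityʳ
      }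
    ; inverse = xor-self , xor-self
    ; ⁻¹-cong = cong id
    }
  }

a : Bool
a = true

module FreeProduct {c₁ ℓ₁ c₂ ℓ₂ : Level} (G : Group c₁ ℓ₁) (H : Group c₂ ℓ₂) where
  private
    module G = Group G
    module H = Group H

  Letter : Set (c₁ ⊔ c₂)
  Letter = G.Carrier ⊎ H.Carrier

  Word : Set (c₁ ⊔ c₂)
  Word = List Letter

  infix 4 _∼_
  data _∼_ : Word → Word → Set (c₁ ⊔ c₂ ⊔ ℓ₁ ⊔ ℓ₂) where
    ∼-refl  : ∀ {u} → u ∼ u
    ∼-sym   : ∀ {u v} → u ∼ v → v ∼ u
    ∼-trans : ∀ {u v w} → u ∼ v → v ∼ w → u ∼ w
    ∼-++    : ∀ {u u′ v v′} → u ∼ u′ → v ∼ v′ → u ++ v ∼ u′ ++ v′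
    mulG    : ∀ x y → inj₁ x ∷ inj₁ y ∷ [] ∼ inj₁ (x G.∙ y) ∷ []
    unitG   : inj₁ G.ε ∷ [] ∼ []
    respG   : ∀ {x y} → x G.≈ y → inj₁ x ∷ [] ∼ inj₁ y ∷ []
    mulH    : ∀ x y → inj₂ x ∷ inj₂ y ∷ [] ∼ inj₂ (x H.∙ y) ∷ []
    unitH   : inj₂ H.ε ∷ [] ∼ []
    respH   : ∀ {x y} → x H.≈ y → inj₂ x ∷ [] ∼ inj₂ y ∷ []

  IsOne : Word → Set (c₁ ⊔ c₂ ⊔ ℓ₁ ⊔ ℓ₂)
  IsOne w = w ∼ []

-- The word  g₀ b₁ g₁ b₂ ⋯ bₙ gₙ, where the k-th separator (k = 1..n) is b k.

interleave : ∀ {a₁ a₂} {A : Set a₁} {B : Set a₂} (n : ℕ) →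
             (Fin (suc n) → A) → (ℕ → B) → List (A ⊎ B)
interleave zero    g b = inj₁ (g zero) ∷ []
interleave (suc n) g b = inj₁ (g zero) ∷ inj₂ (b 1) ∷ interleave n (g ∘ suc) (b ∘ suc)

altPow : ∀ {c ℓ} (H : Group c ℓ) → Group.Carrier H → ℕ → Group.Carrier H
altPow H h zero    = h
altPow H h (suc k) = Group._⁻¹ H (altPow H h k)

module Submission where

-- Rewriting a word of G * H by merging adjacent letters of a factor and deleting trivial
-- letters is terminating and (up to letterwise equality) confluent, so a word represents 1
-- iff it reduces to the empty word.  Replacing h⁻¹, h, h⁻¹, … by a and back matches the
-- reductions of the two words step for step; h ≠ 1 is needed so that no letter h^{±1} of
-- G * H can be deleted without its partner.

open import Defs
open import Level using (Level; _⊔_)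
open import Algebra.Bundles using (Group)
import Algebra.Properties.Group as GroupProperties
open import Data.Bool using (Bool; true; false; _xor_)
open import Data.Nat using (ℕ; zero; suc; _<_; s≤s)
open import Data.Nat.Induction using (<-wellFounded)
open import Data.Nat.Properties using (≤-refl)
open import Data.Fin using (Fin; suc)
open import Data.List using ([]; _∷_; _++_; length)
open import Data.List.Relation.Binary.Pointwise as Listʷ using ([]; _∷_)
open import Data.Sum using (inj₁; inj₂)
open import Data.Sum.Relation.Binary.Pointwise as Sumʷ using (inj₁; inj₂)
open import Data.Product using (∃; _×_; _,_)
open import Data.Empty using (⊥-elim)
open import Function using (_∘_; flip)
open import Function.Bundles using (_⇔_; mk⇔)
open import Induction.WellFounded using (WellFounded; Acc; acc; module Subrelation)
import Relation.Binary.Construct.On as On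
open import Relation.Binary.Construct.Closure.ReflexiveTransitive using (Star; ε; _◅_; _◅◅_; gmap)
open import Relation.Nullary using (¬_)

module FreeProductWords {c₁ ℓ₁ c₂ ℓ₂ : Level} (G : Group c₁ ℓ₁) (H : Group c₂ ℓ₂) where
  open FreeProduct G H
  private
    module G = Group G
    module H = Group H
    ℓ = c₁ ⊔ c₂ ⊔ ℓ₁ ⊔ ℓ₂

  ∼-prefix : ∀ {u v} w → u ∼ v → u ++ w ∼ v ++ w
  ∼-prefix w p = ∼-++ p ∼-refl

  ∼-cons : ∀ l {u v} → u ∼ v → l ∷ u ∼ l ∷ v
  ∼-cons l p = ∼-++ {u = l ∷ []} ∼-refl p

  infix 4 _≋_ _⟶_ _⟶*_

  _≋_ : Word → Word → Set ℓ
  _≋_ = Listʷ.Pointwise (Sumʷ.Pointwise G._≈_ H._≈_)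

  ≋-refl : ∀ {u} → u ≋ u
  ≋-refl = Listʷ.refl (Sumʷ.⊎-refl G.refl H.refl)

  ≋-sym : ∀ {u v} → u ≋ v → v ≋ u
  ≋-sym = Listʷ.symmetric (Sumʷ.⊎-symmetric G.sym H.sym)

  ≋-trans : ∀ {u v w} → u ≋ v → v ≋ w → u ≋ w
  ≋-trans = Listʷ.transitive (Sumʷ.⊎-transitive G.trans H.trans)

  data _⟶_ : Word → Word → Set ℓ where
    merge₁ : ∀ x y u → inj₁ x ∷ inj₁ y ∷ u ⟶ inj₁ (x G.∙ y) ∷ u
    merge₂ : ∀ x y u → inj₂ x ∷ inj₂ y ∷ u ⟶ inj₂ (x H.∙ y) ∷ u
    drop₁  : ∀ {x} u → x G.≈ G.ε → inj₁ x ∷ u ⟶ u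
    drop₂  : ∀ {x} u → x H.≈ H.ε → inj₂ x ∷ u ⟶ u
    cons   : ∀ l {u v} → u ⟶ v → l ∷ u ⟶ l ∷ v

  _⟶*_ : Word → Word → Set ℓ
  _⟶*_ = Star _⟶_

  ⟶-shortens : ∀ {u v} → u ⟶ v → length v < length u
  ⟶-shortens (merge₁ x y u) = ≤-refl
  ⟶-shortens (merge₂ x y u) = ≤-refl
  ⟶-shortens (drop₁ u _)    = ≤-refl
  ⟶-shortens (drop₂ u _)    = ≤-refl
  ⟶-shortens (cons l s)     = s≤s (⟶-shortens s)

  ⟶-wellFounded : WellFounded (flip _⟶_)
  ⟶-wellFounded = Subrelation.wellFounded ⟶-shortens (On.wellFounded length <-wellFounded)

  ⟶*-cons : ∀ l {u v} → u ⟶* v → l ∷ u ⟶* l ∷ v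
  ⟶*-cons l = gmap (l ∷_) (cons l)

  ⟶-++⁺ʳ : ∀ {u u′} v → u ⟶ u′ → u ++ v ⟶ u′ ++ v
  ⟶-++⁺ʳ v (merge₁ x y u) = merge₁ x y _
  ⟶-++⁺ʳ v (merge₂ x y u) = merge₂ x y _
  ⟶-++⁺ʳ v (drop₁ u e)    = drop₁ _ e
  ⟶-++⁺ʳ v (drop₂ u e)    = drop₂ _ e
  ⟶-++⁺ʳ v (cons l s)     = cons l (⟶-++⁺ʳ v s)

  ⟶*-++⁺ˡ : ∀ u {v v′} → v ⟶* v′ → u ++ v ⟶* u ++ v′
  ⟶*-++⁺ˡ []      r = r
  ⟶*-++⁺ˡ (l ∷ u) r = ⟶*-cons l (⟶*-++⁺ˡ u r)

  ⟶*-++⁺ : ∀ {u u′ v v′} → u ⟶* u′ → v ⟶* v′ → u ++ v ⟶* u′ ++ v′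
  ⟶*-++⁺ {u′ = u′} {v = v} r s = gmap (_++ v) (⟶-++⁺ʳ v) r ◅◅ ⟶*-++⁺ˡ u′ s

  ≋-step : ∀ {u u′ v} → u ≋ u′ → u ⟶ v → ∃ λ v′ → u′ ⟶ v′ × v ≋ v′
  ≋-step (inj₁ p ∷ inj₁ q ∷ r) (merge₁ x y u) = _ , merge₁ _ _ _ , inj₁ (G.∙-cong p q) ∷ r
  ≋-step (inj₂ p ∷ inj₂ q ∷ r) (merge₂ x y u) = _ , merge₂ _ _ _ , inj₂ (H.∙-cong p q) ∷ r
  ≋-step (inj₁ p ∷ r) (drop₁ u e) = _ , drop₁ _ (G.trans (G.sym p) e) , r
  ≋-step (inj₂ p ∷ r) (drop₂ u e) = _ , drop₂ _ (H.trans (H.sym p) e) , r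
  ≋-step (p ∷ r) (cons l s) with ≋-step r s
  ... | _ , s′ , r′ = _ , cons _ s′ , p ∷ r′

  ≋-steps : ∀ {u u′ v} → u ≋ u′ → u ⟶* v → ∃ λ v′ → u′ ⟶* v′ × v ≋ v′
  ≋-steps e ε = _ , ε , e
  ≋-steps e (s ◅ r) with ≋-step e s
  ... | _ , s′ , e′ with ≋-steps e′ r
  ... | _ , r′ , e″ = _ , s′ ◅ r′ , e″

  record Joinable (u v : Word) : Set ℓ where
    constructor joined
    field
      {meetˡ meetʳ} : Word
      reduceˡ : u ⟶* meetˡ
      reduceʳ : v ⟶* meetʳ
      meet    : meetˡ ≋ meetʳ

  ≋⇒joinable : ∀ {u v} → u ≋ v → Joinable u v
  ≋⇒joinable = joined ε ε

  joinable-sym : ∀ {u v} → Joinable u v → Joinable v u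
  joinable-sym (joined r s e) = joined s r (≋-sym e)

  joinable-cons : ∀ l {u v} → Joinable u v → Joinable (l ∷ u) (l ∷ v)
  joinable-cons l (joined r s e) = joined (⟶*-cons l r) (⟶*-cons l s) (Sumʷ.⊎-refl G.refl H.refl ∷ e)

  merge₁-peak : ∀ x y u {v} → inj₁ x ∷ inj₁ y ∷ u ⟶ v → Joinable (inj₁ (x G.∙ y) ∷ u) v
  merge₁-peak x y u (merge₁ _ _ _) = ≋⇒joinable ≋-refl
  merge₁-peak x y u (drop₁ _ e) =
    ≋⇒joinable (inj₁ (G.trans (G.∙-cong e G.refl) (G.identityˡ y)) ∷ ≋-refl)
  merge₁-peak x y u (cons _ (merge₁ _ z _)) =
    joined (merge₁ _ _ _ ◅ ε) (merge₁ _ _ _ ◅ ε) (inj₁ (G.assoc x y z) ∷ ≋-refl)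
  merge₁-peak x y u (cons _ (drop₁ _ e)) =
    ≋⇒joinable (inj₁ (G.trans (G.∙-cong G.refl e) (G.identityʳ x)) ∷ ≋-refl)
  merge₁-peak x y u (cons _ (cons _ s)) = joined (cons _ s ◅ ε) (merge₁ _ _ _ ◅ ε) ≋-refl

  merge₂-peak : ∀ x y u {v} → inj₂ x ∷ inj₂ y ∷ u ⟶ v → Joinable (inj₂ (x H.∙ y) ∷ u) v
  merge₂-peak x y u (merge₂ _ _ _) = ≋⇒joinable ≋-refl
  merge₂-peak x y u (drop₂ _ e) =
    ≋⇒joinable (inj₂ (H.trans (H.∙-cong e H.refl) (H.identityˡ y)) ∷ ≋-refl)
  merge₂-peak x y u (cons _ (merge₂ _ z _)) =
    joined (merge₂ _ _ _ ◅ ε) (merge₂ _ _ _ ◅ ε) (inj₂ (H.assoc x y z) ∷ ≋-refl)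
  merge₂-peak x y u (cons _ (drop₂ _ e)) =
    ≋⇒joinable (inj₂ (H.trans (H.∙-cong H.refl e) (H.identityʳ x)) ∷ ≋-refl)
  merge₂-peak x y u (cons _ (cons _ s)) = joined (cons _ s ◅ ε) (merge₂ _ _ _ ◅ ε) ≋-refl

  drop-peak : ∀ l u {v} → (∀ {w} → l ∷ w ⟶ w) → l ∷ u ⟶ v → Joinable u v
  drop-peak l u d (merge₁ x y _) = joinable-sym (merge₁-peak x y _ d)
  drop-peak l u d (merge₂ x y _) = joinable-sym (merge₂-peak x y _ d)
  drop-peak l u d (drop₁ _ _)    = ≋⇒joinable ≋-refl
  drop-peak l u d (drop₂ _ _)    = ≋⇒joinable ≋-refl
  drop-peak l u d (cons _ s)     = joined (s ◅ ε) (d ◅ ε) ≋-refl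

  locally-confluent : ∀ {u v₁ v₂} → u ⟶ v₁ → u ⟶ v₂ → Joinable v₁ v₂
  locally-confluent (merge₁ x y u) s = merge₁-peak x y u s
  locally-confluent (merge₂ x y u) s = merge₂-peak x y u s
  locally-confluent (drop₁ u e)    s = drop-peak _ u (drop₁ _ e) s
  locally-confluent (drop₂ u e)    s = drop-peak _ u (drop₂ _ e) s
  locally-confluent (cons l s) (merge₁ x y u) = joinable-sym (merge₁-peak x y u (cons l s))
  locally-confluent (cons l s) (merge₂ x y u) = joinable-sym (merge₂-peak x y u (cons l s))
  locally-confluent (cons l s) (drop₁ u e)    = joinable-sym (drop-peak _ u (drop₁ _ e) (cons l s))
  locally-confluent (cons l s) (drop₂ u e)    = joinable-sym (drop-peak _ u (drop₂ _ e) (cons l s))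
  locally-confluent (cons l s) (cons _ t)     = joinable-cons l (locally-confluent s t)

  -- Newman's lemma, modulo ≋: the two local joins are glued by transporting reductions along ≋.
  confluent : ∀ {u v₁ v₂} → Acc (flip _⟶_) u → u ⟶* v₁ → u ⟶* v₂ → Joinable v₁ v₂
  confluent _ ε r = joined r ε ≋-refl
  confluent _ (s ◅ r) ε = joined ε (s ◅ r) ≋-refl
  confluent (acc rs) (s₁ ◅ r₁) (s₂ ◅ r₂) with locally-confluent s₁ s₂
  ... | joined p₁ p₂ e with confluent (rs s₁) r₁ p₁
  ... | joined q₁ q₂ e₁ with ≋-steps e q₂
  ... | _ , t₂ , e₂ with confluent (rs s₂) r₂ (p₂ ◅◅ t₂)
  ... | joined u₁ u₂ e₃ with ≋-steps (≋-sym (≋-trans e₁ e₂)) u₂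
  ... | _ , t₃ , e₄ = joined (q₁ ◅◅ t₃) u₁ (≋-sym (≋-trans e₃ e₄))

  joinable-trans : ∀ {u v w} → Joinable u v → Joinable v w → Joinable u w
  joinable-trans {v = v} (joined p q e) (joined p′ q′ e′) with confluent (⟶-wellFounded v) q p′
  ... | joined r r′ e″ with ≋-steps (≋-sym e) r | ≋-steps e′ r′
  ... | _ , rˡ , eˡ | _ , rʳ , eʳ =
    joined (p ◅◅ rˡ) (q′ ◅◅ rʳ) (≋-trans (≋-sym eˡ) (≋-trans e″ eʳ))

  ∼⇒joinable : ∀ {u v} → u ∼ v → Joinable u v
  ∼⇒joinable ∼-refl        = ≋⇒joinable ≋-refl
  ∼⇒joinable (∼-sym p)     = joinable-sym (∼⇒joinable p)
  ∼⇒joinable (∼-trans p q) = joinable-trans (∼⇒joinable p) (∼⇒joinable q)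
  ∼⇒joinable (∼-++ p q) with ∼⇒joinable p | ∼⇒joinable q
  ... | joined r r′ e | joined s s′ e′ = joined (⟶*-++⁺ r s) (⟶*-++⁺ r′ s′) (Listʷ.++⁺ e e′)
  ∼⇒joinable (mulG x y) = joined (merge₁ x y [] ◅ ε) ε ≋-refl
  ∼⇒joinable unitG      = joined (drop₁ [] G.refl ◅ ε) ε ≋-refl
  ∼⇒joinable (respG p)  = ≋⇒joinable (inj₁ p ∷ [])
  ∼⇒joinable (mulH x y) = joined (merge₂ x y [] ◅ ε) ε ≋-refl
  ∼⇒joinable unitH      = joined (drop₂ [] H.refl ◅ ε) ε ≋-refl
  ∼⇒joinable (respH p)  = ≋⇒joinable (inj₂ p ∷ [])

  IsOne⇒⟶*[] : ∀ {u} → IsOne u → u ⟶* []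
  IsOne⇒⟶*[] p with ∼⇒joinable p
  ... | joined r ε []      = r
  ... | joined r (() ◅ _) _

module Correspondence {c₁ ℓ₁ c₂ ℓ₂ : Level} (G : Group c₁ ℓ₁) (H : Group c₂ ℓ₂) where
  private
    module G = Group G
    module H = Group H
    module Hᵖ = GroupProperties H
    module G*H = FreeProduct G H
    module G*Z2 = FreeProduct G Z2
    module W = FreeProductWords G H
    module Wᶻ = FreeProductWords G Z2

  ⁻¹-nontrivial : ∀ {c} → ¬ (c H.≈ H.ε) → ¬ (c H.⁻¹ H.≈ H.ε)
  ⁻¹-nontrivial c≉ε c⁻¹≈ε = c≉ε (Hᵖ.⁻¹-injective (H.trans c⁻¹≈ε (H.sym Hᵖ.ε⁻¹≈ε)))

  next : H.Carrier → Bool → H.Carrier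
  next c false = c
  next c true  = c H.⁻¹

  next-cong : ∀ {c c′} b → c H.≈ c′ → next c b H.≈ next c′ b
  next-cong false e = e
  next-cong true  e = H.⁻¹-cong e

  next-nontrivial : ∀ {c} b → ¬ (c H.≈ H.ε) → ¬ (next c b H.≈ H.ε)
  next-nontrivial false c≉ε = c≉ε
  next-nontrivial true  c≉ε = ⁻¹-nontrivial c≉ε

  next-xor : ∀ c b₁ b₂ → next (next c b₁) b₂ H.≈ next c (b₁ xor b₂)
  next-xor c false b₂    = H.refl
  next-xor c true  false = H.refl
  next-xor c true  true  = Hᵖ.⁻¹-involutive c

  data LetterMatches (c : H.Carrier) : H.Carrier → Bool → Set (c₂ ⊔ ℓ₂) where
    trivial   : ∀ {x} → x H.≈ H.ε → LetterMatches c x false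
    generator : ∀ {x} → x H.≈ c → LetterMatches c x true

  -- Matches c u w: u arises from w by replacing the successive letters a by c, c⁻¹, c, …
  -- and the identity letters of ℤ/2ℤ by trivial letters of H.
  data Matches : H.Carrier → G*H.Word → G*Z2.Word → Set (c₁ ⊔ c₂ ⊔ ℓ₂) where
    []  : ∀ {c} → Matches c [] []
    g∷_ : ∀ {c x u w} → Matches c u w → Matches c (inj₁ x ∷ u) (inj₁ x ∷ w)
    h∷  : ∀ {c x b u w} → LetterMatches c x b → Matches (next c b) u w →
          Matches c (inj₂ x ∷ u) (inj₂ b ∷ w)

  letterMatches-cong : ∀ {c c′ x b} → c H.≈ c′ → LetterMatches c x b → LetterMatches c′ x b
  letterMatches-cong e (trivial p)   = trivial p
  letterMatches-cong e (generator p) = generator (H.trans p e)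

  matches-cong : ∀ {c c′ u w} → c H.≈ c′ → Matches c u w → Matches c′ u w
  matches-cong e []       = []
  matches-cong e (g∷ m)   = g∷ matches-cong e m
  matches-cong e (h∷ {b = b} p m) = h∷ (letterMatches-cong e p) (matches-cong (next-cong b e) m)

  letterMatches-∙ : ∀ {c x y b₁ b₂} → LetterMatches c x b₁ → LetterMatches (next c b₁) y b₂ →
                    LetterMatches c (x H.∙ y) (b₁ xor b₂)
  letterMatches-∙ (trivial p)   (trivial q)   = trivial (H.trans (H.∙-cong p q) (H.identityˡ _))
  letterMatches-∙ (trivial p)   (generator q) = generator (H.trans (H.∙-cong p q) (H.identityˡ _))
  letterMatches-∙ (generator p) (trivial q)   = generator (H.trans (H.∙-cong p q) (H.identityʳ _))
  letterMatches-∙ (generator p) (generator q) = trivial (H.trans (H.∙-cong p q) (H.inverseʳ _))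

  matches-merge : ∀ {c x y b₁ b₂ u w} →
                  Matches c (inj₂ x ∷ inj₂ y ∷ u) (inj₂ b₁ ∷ inj₂ b₂ ∷ w) →
                  Matches c (inj₂ (x H.∙ y) ∷ u) (inj₂ (b₁ xor b₂) ∷ w)
  matches-merge {c} {b₁ = b₁} {b₂} (h∷ p (h∷ q m)) =
    h∷ (letterMatches-∙ p q) (matches-cong (next-xor c b₁ b₂) m)

  -- The correspondence is a bisimulation between reductions of the two free products.
  matches-⟶ᴴ : ∀ {c u u′ w} → ¬ (c H.≈ H.ε) → u W.⟶ u′ → Matches c u w →
               ∃ λ w′ → w G*Z2.∼ w′ × Matches c u′ w′
  matches-⟶ᴴ c≉ε (W.merge₁ x y u) (g∷ g∷ m)       = _ , Wᶻ.∼-prefix _ (G*Z2.mulG x y) , g∷ m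
  matches-⟶ᴴ c≉ε (W.merge₂ x y u) m@(h∷ _ (h∷ _ _)) = _ , Wᶻ.∼-prefix _ (G*Z2.mulH _ _) , matches-merge m
  matches-⟶ᴴ c≉ε (W.drop₁ u e) (g∷ m) =
    _ , Wᶻ.∼-prefix _ (G*Z2.∼-trans (G*Z2.respG e) G*Z2.unitG) , m
  matches-⟶ᴴ c≉ε (W.drop₂ u e) (h∷ (trivial _) m)   = _ , Wᶻ.∼-prefix _ G*Z2.unitH , m
  matches-⟶ᴴ c≉ε (W.drop₂ u e) (h∷ (generator p) m) = ⊥-elim (c≉ε (H.trans (H.sym p) e))
  matches-⟶ᴴ c≉ε (W.cons _ s) (g∷ m) with matches-⟶ᴴ c≉ε s m
  ... | _ , p , m′ = _ , Wᶻ.∼-cons _ p , g∷ m′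
  matches-⟶ᴴ c≉ε (W.cons _ s) (h∷ {b = b} q m) with matches-⟶ᴴ (next-nontrivial b c≉ε) s m
  ... | _ , p , m′ = _ , Wᶻ.∼-cons _ p , h∷ q m′

  matches-⟶ᶻ : ∀ {c u w w′} → w Wᶻ.⟶ w′ → Matches c u w →
               ∃ λ u′ → u G*H.∼ u′ × Matches c u′ w′
  matches-⟶ᶻ (Wᶻ.merge₁ x y w) (g∷ g∷ m)       = _ , W.∼-prefix _ (G*H.mulG x y) , g∷ m
  matches-⟶ᶻ (Wᶻ.merge₂ x y w) m@(h∷ _ (h∷ _ _)) = _ , W.∼-prefix _ (G*H.mulH _ _) , matches-merge m
  matches-⟶ᶻ (Wᶻ.drop₁ w e) (g∷ m) =
    _ , W.∼-prefix _ (G*H.∼-trans (G*H.respG e) G*H.unitG) , m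
  matches-⟶ᶻ (Wᶻ.drop₂ w e) (h∷ (trivial p) m) =
    _ , W.∼-prefix _ (G*H.∼-trans (G*H.respH p) G*H.unitH) , m
  matches-⟶ᶻ (Wᶻ.drop₂ w ()) (h∷ (generator _) _)
  matches-⟶ᶻ (Wᶻ.cons _ s) (g∷ m) with matches-⟶ᶻ s m
  ... | _ , p , m′ = _ , W.∼-cons _ p , g∷ m′
  matches-⟶ᶻ (Wᶻ.cons _ s) (h∷ q m) with matches-⟶ᶻ s m
  ... | _ , p , m′ = _ , W.∼-cons _ p , h∷ q m′

  matches-IsOneᴴ : ∀ {c u w} → ¬ (c H.≈ H.ε) → u W.⟶* [] → Matches c u w → G*Z2.IsOne w
  matches-IsOneᴴ c≉ε ε [] = G*Z2.∼-refl
  matches-IsOneᴴ c≉ε (s ◅ r) m with matches-⟶ᴴ c≉ε s m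
  ... | _ , p , m′ = G*Z2.∼-trans p (matches-IsOneᴴ c≉ε r m′)

  matches-IsOneᶻ : ∀ {c u w} → w Wᶻ.⟶* [] → Matches c u w → G*H.IsOne u
  matches-IsOneᶻ ε [] = G*H.∼-refl
  matches-IsOneᶻ (s ◅ r) m with matches-⟶ᶻ s m
  ... | _ , p , m′ = G*H.∼-trans p (matches-IsOneᶻ r m′)

  altPow-suc : ∀ c k → altPow H c (suc k) H.≈ altPow H (c H.⁻¹) k
  altPow-suc c zero    = H.refl
  altPow-suc c (suc k) = H.⁻¹-cong (altPow-suc c k)

  interleave-matches : ∀ n (g : Fin (suc n) → G.Carrier) (b : ℕ → H.Carrier) c →
                       (∀ k → b (suc k) H.≈ altPow H c k) →
                       Matches c (interleave n g b) (interleave n g (λ _ → a))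
  interleave-matches zero    g b c b≈ = g∷ []
  interleave-matches (suc n) g b c b≈ =
    g∷ h∷ (generator (b≈ 0))
      (interleave-matches n (g ∘ suc) (b ∘ suc) (c H.⁻¹) (λ k → H.trans (b≈ (suc k)) (altPow-suc c k)))

mainTheorem5 : {c₁ ℓ₁ c₂ ℓ₂ : Level} (G : Group c₁ ℓ₁) (H : Group c₂ ℓ₂)
    (n : ℕ) (g : Fin (suc n) → Group.Carrier G) (h : Group.Carrier H) →
    ¬ (Group._≈_ H h (Group.ε H)) →
    FreeProduct.IsOne G Z2 (interleave n g (λ _ → a))
    ⇔ FreeProduct.IsOne G H (interleave n g (altPow H h))
mainTheorem5 G H n g h h≉ε = mk⇔
  (λ w≈1 → matches-IsOneᶻ (Wᶻ.IsOne⇒⟶*[] w≈1) start)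
  (λ u≈1 → matches-IsOneᴴ (⁻¹-nontrivial h≉ε) (W.IsOne⇒⟶*[] u≈1) start)
  where
  open Group H using (_⁻¹)
  open Correspondence G H
  module W = FreeProductWords G H
  module Wᶻ = FreeProductWords G Z2
  start : Matches (h ⁻¹) (interleave n g (altPow H h)) (interleave n g (λ _ → a))
  start = interleave-matches n g (altPow H h) (h ⁻¹) (altPow-suc h)
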